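{- Let $n\ge1$, $\tau\in\mathfrak S_n$, and write $\tau=\tau^a\,n\,\tau^b$. Then $\tau\in\mathrm{Sort}_n(\mathfrak{s}_{\underline{12}3})$ if and only if (1) every entry of $\tau^a$ is greater than every entry of $\tau^b$, (2) $\tau^a$ avoids both $3\underline{21}$ and $132$, and (3) $\tau^b$ avoids $213$.
   Context: A pattern is a permutation $\sigma$ in which some blocks of consecutive entries may be underlined; a sequence of distinct numbers contains it if it has a subsequence order-isomorphic to $\sigma$ whose entries corresponding to a common underlined block are adjacent in the sequence; otherwise it avoids $\sigma$. Pattern-avoiding stack map $\mathfrak{s}_\sigma$: process input $\tau_1,\dots,\tau_n$ in order; when $\tau_i$ is next, while the stack is nonempty and the sequence formed by placing $\tau_i$ on top of the stack, read top to bottom, contains $\sigma$ (underlined entries adjacent in the stack), pop the top entry to the output; then push $\tau_i$; at the end pop all remaining entries top to bottom to the output. West's stack-sorting map $s$ pushes each input entry after popping all smaller stack entries to the output, emptying the stack at the end. $\mathrm{Sort}_n(\mathfrak{s}_\sigma)=\{\tau\in\mathfrak S_n: s(\mathfrak{s}_\sigma(\tau))=12\cdots n\}$ (equivalently $\mathfrak{s}_\sigma(\tau)$ avoids $231$). -}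

module Defs where

open import Data.Nat using (ℕ; zero; suc; _<_; _<ᵇ_; _≡ᵇ_)
open import Data.Bool using (Bool; true; false; _∧_; if_then_else_)
open import Data.List using (List; []; _∷_; _++_; map; concat; length; take; drop; upTo)
open import Data.Bool.ListAction using (any)
open import Data.Product using (_×_; _,_)
open import Relation.Binary.PropositionalEquality using (_≡_)
open import Data.List.Relation.Binary.Permutation.Propositional using (_↭_)

-- A pattern is a list of blocks; each block is a nonempty list of pattern
-- values.  A block of length ≥ 2 is an underlined block; a block of length 1
-- is an ordinary (non-underlined) entry.  E.g. 1̲2̲3 = [[1,2],[3]].
Pattern : Set
Pattern = List (List ℕ)

-- All choices of entries of a sequence matching the block structure:
-- blocks are taken left to right, each block occupying |block| *adjacent*
-- positions of the sequence; returns the chosen values in order.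
embeds : Pattern → List ℕ → List (List ℕ)
embeds [] xs = [] ∷ []
embeds (b ∷ bs) [] = []
embeds (b ∷ bs) (x ∷ xs) =
  embeds (b ∷ bs) xs ++
  map (λ ys → take (length b) (x ∷ xs) ++ ys) (embeds bs (drop (length b) (x ∷ xs)))

sameLength : List ℕ → List ℕ → Bool
sameLength [] [] = true
sameLength (_ ∷ xs) (_ ∷ ys) = sameLength xs ys
sameLength _ _ = false

_⇔ᵇ_ : Bool → Bool → Bool
true ⇔ᵇ b = b
false ⇔ᵇ true = false
false ⇔ᵇ false = true

headAgrees : ℕ → ℕ → List ℕ → List ℕ → Bool
headAgrees x y (x' ∷ xs) (y' ∷ ys) =
  ((x <ᵇ x') ⇔ᵇ (y <ᵇ y')) ∧ ((x' <ᵇ x) ⇔ᵇ (y' <ᵇ y)) ∧ headAgrees x y xs ys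
headAgrees _ _ _ _ = true

orderIso : List ℕ → List ℕ → Bool
orderIso (x ∷ xs) (y ∷ ys) = headAgrees x y xs ys ∧ orderIso xs ys
orderIso [] [] = true
orderIso _ _ = false

contains : Pattern → List ℕ → Bool
contains σ w = any (λ ys → orderIso ys (concat σ)) (embeds σ w)

Avoids : List ℕ → Pattern → Set
Avoids w σ = contains σ w ≡ false

-- Pattern-avoiding stack map 𝔰_σ.  The stack is a list, top first.
module _ (σ : Pattern) where
  popWhile : ℕ → List ℕ → List ℕ × List ℕ
  popWhile x [] = [] , []
  popWhile x (t ∷ st) with contains σ (x ∷ t ∷ st)
  ... | true  with popWhile x st
  ...   | out , rest = t ∷ out , rest
  popWhile x (t ∷ st) | false = [] , t ∷ st

  runσ : List ℕ → List ℕ → List ℕ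
  runσ [] st = st
  runσ (x ∷ xs) st with popWhile x st
  ... | out , rest = out ++ runσ xs (x ∷ rest)

  stackMap : List ℕ → List ℕ
  stackMap τ = runσ τ []

popSmaller : ℕ → List ℕ → List ℕ × List ℕ
popSmaller x [] = [] , []
popSmaller x (t ∷ st) with t <ᵇ x
... | true with popSmaller x st
...   | out , rest = t ∷ out , rest
popSmaller x (t ∷ st) | false = [] , t ∷ st

runWest : List ℕ → List ℕ → List ℕ
runWest [] st = st
runWest (x ∷ xs) st with popSmaller x st
... | out , rest = out ++ runWest xs (x ∷ rest)

west : List ℕ → List ℕ
west τ = runWest τ []

idPerm : ℕ → List ℕ
idPerm n = map suc (upTo n)

IsPerm : ℕ → List ℕ → Set
IsPerm n τ = τ ↭ idPerm n

InSort : Pattern → ℕ → List ℕ → Set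
InSort σ n τ = IsPerm n τ × west (stackMap σ τ) ≡ idPerm n

p1̲2̲3 p32̲1̲ p132 p213 : Pattern
p1̲2̲3 = (1 ∷ 2 ∷ []) ∷ (3 ∷ []) ∷ []
p32̲1̲ = (3 ∷ []) ∷ (2 ∷ 1 ∷ []) ∷ []
p132 = (1 ∷ []) ∷ (3 ∷ []) ∷ (2 ∷ []) ∷ []
p213 = (2 ∷ []) ∷ (1 ∷ []) ∷ (3 ∷ []) ∷ []

{-# OPTIONS --safe #-}
module Submission where

-- While τᵃ is read, the stack of 𝔰 = 𝔰_{1̲2̲3} never contains 1̲2̲3, so an
-- entry is popped only by a smaller incoming one, and every entry output so far keeps a
-- smaller entry in the stack. Pushing n pops nothing, and above n the machine behaves like
-- West's map s′ for the reversed order: x pops t exactly when x < t, n completing the 1̲2̲3.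
-- Hence 𝔰(τ) = O · s′(τᵇ) · n · R, with O the output and R the stack left by τᵃ. By Knuth,
-- s(𝔰(τ)) is the identity iff 𝔰(τ) avoids 231. An entry of O, then n, then a smaller entry
-- of R form a 231, so O is empty; this happens iff τᵃ reversed avoids 1̲2̲3, i.e. τᵃ avoids
-- 32̲1̲, and then R is τᵃ reversed. Finally s′(τᵇ) · n · R, n being its maximum, avoids 231
-- iff s′(τᵇ) lies entrywise below R and both avoid 231. R avoids 231 iff τᵃ avoids 132, and
-- an output of s′ avoids 231 iff it is decreasing, which by Knuth for the reversed order
-- means that τᵇ avoids 213.

open import Defs
open import Level using (0ℓ)
open import Data.Bool using (Bool; true; false; T; if_then_else_)
open import Data.Bool.Properties using (T-∧; T-≡)
open import Data.Empty using (⊥; ⊥-elim)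
open import Data.Unit using (⊤; tt)
open import Data.Nat using (ℕ; suc; _≤_; _<_; _<ᵇ_; s≤s)
open import Data.Nat.Induction using (<-wellFounded)
open import Data.Nat.Properties using (<-isStrictTotalOrder; ≤-totalOrder; _<?_; _>?_; <⇒≤; <⇒≢; ≤∧≢⇒<; <ᵇ⇒<; <⇒<ᵇ; <-trans; <-asym; suc-injective)
open import Data.Product using (∃-syntax; _×_; _,_; proj₁; proj₂; swap; map₁)
open import Data.Product.Function.NonDependent.Propositional using (_×-⇔_)
open import Data.Sum using (inj₁; inj₂)
open import Data.List using (List; []; _∷_; _++_; _ʳ++_; map; reverse; length; zip; concat; [_])
open import Data.List.Properties using (reverse-++; ++-assoc; ++-identityʳ; reverse-involutive; length-++-sucʳ; length-++-≤ˡ; length-++-≤ʳ; ++-conicalˡ; ++-conicalʳ)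
open import Data.List.Membership.Propositional using (_∈_; find; lose)
open import Data.List.Membership.Propositional.Properties using (∈-++⁻; ∈-++⁺ˡ; ∈-++⁺ʳ; ∈-map⁻; ∈-map⁺; ∈-upTo⁻)
open import Data.List.Relation.Binary.Sublist.Propositional using (_⊆_; []; _∷_; _∷ʳ_; ⊆-refl; ⊆-trans; from∈; to∈)
open import Data.List.Relation.Binary.Sublist.Propositional.Properties as Sublist using (reverse⁺; reverse⁻; ∷⁻)
open import Data.List.Relation.Binary.Permutation.Propositional using (_↭_; ↭-refl; ↭-prep; ↭-sym; ↭-trans; ↭-reflexive; ↭⇒↭ₛ; module PermutationReasoning)
open import Data.List.Relation.Binary.Permutation.Propositional.Properties using (++⁺; ++⁺ˡ; ++-comm; shift; shifts; ↭-reverse; All-resp-↭; ∈-resp-↭)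
import Data.List.Relation.Binary.Permutation.Setoid.Properties as PermSetoid
open import Data.List.Relation.Binary.Pointwise using (Pointwise-≡⇒≡)
open import Data.List.Relation.Unary.All as All using (All; []; _∷_)
open import Data.List.Relation.Unary.All.Properties as AllP using (All-swap)
open import Data.List.Relation.Unary.AllPairs as AllPairs using (AllPairs; []; _∷_)
import Data.List.Relation.Unary.AllPairs.Properties as APP
open import Data.List.Relation.Unary.Any using (Any; here; there)
import Data.List.Relation.Unary.Any.Properties as Any
open import Data.List.Relation.Unary.Linked.Properties using (AllPairs⇒Linked)
open import Data.List.Relation.Unary.Sorted.TotalOrder using (Sorted)
open import Data.List.Relation.Unary.Sorted.TotalOrder.Properties using (↗↭↗⇒≋)
open import Data.List.Relation.Unary.Unique.Propositional using (Unique)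
open import Function using (_∘_; const; case_of_; _on_)
open import Function.Bundles using (_⇔_; mk⇔; Equivalence)
open import Function.Construct.Composition using (_⇔-∘_)
open import Function.Properties.Equivalence using () renaming (sym to ⇔-sym)
import Function.Related.Propositional as Related
open import Function.Related.TypeIsomorphisms using (¬-cong-⇔)
open import Induction.WellFounded using (Acc; acc)
open import Relation.Binary using (Rel; Decidable; IsStrictTotalOrder; tri<; tri≈; tri>)
import Relation.Binary.Construct.Flip.EqAndOrd as Flip
import Relation.Binary.Construct.On as On
open import Relation.Binary.PropositionalEquality using (_≡_; refl; sym; trans; cong; cong₂; subst; setoid; module ≡-Reasoning)
open import Relation.Nullary using (¬_; does)
open import Relation.Nullary.Decidable using (dec-true; dec-false)

open Equivalence using (to; from)

module _ {A : Set} where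

  ⊆-++⁻ : ∀ {xs : List A} ys {zs} → xs ⊆ ys ++ zs →
    ∃[ xs₁ ] ∃[ xs₂ ] xs ≡ xs₁ ++ xs₂ × xs₁ ⊆ ys × xs₂ ⊆ zs
  ⊆-++⁻ []       s        = [] , _ , refl , [] , s
  ⊆-++⁻ (y ∷ ys) (y ∷ʳ s) with ⊆-++⁻ ys s
  ... | xs₁ , xs₂ , refl , s₁ , s₂ = xs₁ , xs₂ , refl , y ∷ʳ s₁ , s₂
  ⊆-++⁻ (y ∷ ys) (refl ∷ s) with ⊆-++⁻ ys s
  ... | xs₁ , xs₂ , refl , s₁ , s₂ = y ∷ xs₁ , xs₂ , refl , refl ∷ s₁ , s₂

  AllPairs-++⁻ : ∀ {R : A → A → Set} xs {ys} → AllPairs R (xs ++ ys) →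
    AllPairs R xs × AllPairs R ys × All (λ x → All (R x) ys) xs
  AllPairs-++⁻ []       rs         = [] , rs , []
  AllPairs-++⁻ (x ∷ xs) (rx ∷ rs) =
    let (rxs , rys , cross) = AllPairs-++⁻ xs rs
    in AllP.++⁻ˡ xs rx ∷ rxs , rys , AllP.++⁻ʳ xs rx ∷ cross

  AllPairs-pair : ∀ {R : A → A → Set} {a b cs w} → (a ∷ b ∷ cs) ⊆ w → AllPairs R w → R a b
  AllPairs-pair (_ ∷ʳ s)   (_ ∷ rs)   = AllPairs-pair s rs
  AllPairs-pair (refl ∷ s) (ra ∷ _) = All.lookup ra (Sublist.Any-resp-⊆ s (here refl))

  length-<-++ˡ : ∀ (L : List A) {m R} → length L < length (L ++ m ∷ R)
  length-<-++ˡ L {m} {R} = subst (length L <_) (sym (length-++-sucʳ L m R)) (s≤s (length-++-≤ˡ L))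

  length-<-++ʳ : ∀ (L : List A) {m R} → length R < length (L ++ m ∷ R)
  length-<-++ʳ L {m} {R} = subst (length R <_) (sym (length-++-sucʳ L m R)) (s≤s (length-++-≤ʳ R {L}))

  Unique-resp-↭ : ∀ {xs ys : List A} → xs ↭ ys → Unique xs → Unique ys
  Unique-resp-↭ p = PermSetoid.Unique-resp-↭ (setoid A) (↭⇒↭ₛ p)

  All²-resp-↭⇔ : ∀ {R : A → A → Set} {xs xs′ ys ys′} → xs ↭ xs′ → ys ↭ ys′ →
    All (λ x → All (R x) ys) xs ⇔ All (λ x → All (R x) ys′) xs′
  All²-resp-↭⇔ p q = mk⇔ (All-resp-↭ p ∘ All.map (All-resp-↭ q))
                         (All-resp-↭ (↭-sym p) ∘ All.map (All-resp-↭ (↭-sym q)))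

module _ {A : Set} where

  Occurs : (A → A → A → Set) → List A → Set
  Occurs R w = ∃[ a ] ∃[ b ] ∃[ c ] (a ∷ b ∷ c ∷ []) ⊆ w × R a b c

  Occurs-mono : ∀ {R u w} → u ⊆ w → Occurs R u → Occurs R w
  Occurs-mono u⊆w (a , b , c , abc⊆u , r) = a , b , c , ⊆-trans abc⊆u u⊆w , r

  Occurs-cong : ∀ {R S : A → A → A → Set} {w} → (∀ {a b c} → R a b c ⇔ S a b c) →
    Occurs R w ⇔ Occurs S w
  Occurs-cong R⇔S = mk⇔ (λ (a , b , c , s , r) → a , b , c , s , R⇔S .to r)
                        (λ (a , b , c , s , r) → a , b , c , s , R⇔S .from r)

  Occurs-reverse : ∀ {R w} → Occurs R (reverse w) ⇔ Occurs (λ a b c → R c b a) w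
  Occurs-reverse = mk⇔ (λ (a , b , c , s , r) → c , b , a , reverse⁻ s , r)
                       (λ (a , b , c , s , r) → c , b , a , reverse⁺ s , r)

Is231 Is132 Is213 : ℕ → ℕ → ℕ → Set
Is231 a b c = c < a × a < b
Is132 a b c = a < c × c < b
Is213 a b c = a < c × b < a

≡false⇔¬T : ∀ {b} → b ≡ false ⇔ (¬ T b)
≡false⇔¬T {false} = mk⇔ (λ _ ()) (const refl)
≡false⇔¬T {true}  = mk⇔ (λ ()) (λ ¬t → ⊥-elim (¬t _))

T-⇔ᵇ : ∀ {x y} → T (x ⇔ᵇ y) ⇔ x ≡ y
T-⇔ᵇ {true}  {true}  = mk⇔ (const refl) (const _)
T-⇔ᵇ {true}  {false} = mk⇔ (λ ()) (λ ())
T-⇔ᵇ {false} {true}  = mk⇔ (λ ()) (λ ())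
T-⇔ᵇ {false} {false} = mk⇔ (const refl) (const _)

<ᵇ≡false : ∀ {a b} → ¬ a < b → (a <ᵇ b) ≡ false
<ᵇ≡false {a} {b} a≮b with a <ᵇ b in e
... | false = refl
... | true  = ⊥-elim (a≮b (<ᵇ⇒< a b (T-≡ .from e)))

ascent⇔< : ∀ {a b} → (((a <ᵇ b) ≡ true) × ((b <ᵇ a) ≡ false)) ⇔ a < b
ascent⇔< {a} {b} = mk⇔ (λ (e , _) → <ᵇ⇒< a b (T-≡ .from e))
                       (λ a<b → T-≡ .to (<⇒<ᵇ a<b) , <ᵇ≡false (<-asym a<b))

SameComparison : ℕ × ℕ → ℕ × ℕ → Set
SameComparison (x , y) (x′ , y′) = ((x <ᵇ x′) ≡ (y <ᵇ y′)) × ((x′ <ᵇ x) ≡ (y′ <ᵇ y))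

T-headAgrees : ∀ {x y xs ys} → length xs ≡ length ys →
  T (headAgrees x y xs ys) ⇔ All (SameComparison (x , y)) (zip xs ys)
T-headAgrees {xs = []}     {[]}     _ = mk⇔ (const []) (const _)
T-headAgrees {xs = _ ∷ xs} {_ ∷ ys} e = mk⇔
  (λ t → let (e₁ , t′) = T-∧ .to t ; (e₂ , t″) = T-∧ .to t′
         in (T-⇔ᵇ .to e₁ , T-⇔ᵇ .to e₂) ∷ T-headAgrees (suc-injective e) .to t″)
  (λ { ((e₁ , e₂) ∷ a) →
    T-∧ .from (T-⇔ᵇ .from e₁ , T-∧ .from (T-⇔ᵇ .from e₂ , T-headAgrees (suc-injective e) .from a)) })

T-orderIso : ∀ {xs ys} → length xs ≡ length ys →
  T (orderIso xs ys) ⇔ AllPairs SameComparison (zip xs ys)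
T-orderIso {[]}     {[]}     _ = mk⇔ (const []) (const _)
T-orderIso {_ ∷ xs} {_ ∷ ys} e = mk⇔
  (λ t → let (h , t′) = T-∧ .to t in T-headAgrees e′ .to h ∷ T-orderIso e′ .to t′)
  (λ { (h ∷ a) → T-∧ .from (T-headAgrees e′ .from h , T-orderIso e′ .from a) })
  where e′ = suc-injective e

T-orderIso⇒length : ∀ {xs ys} → T (orderIso xs ys) → length xs ≡ length ys
T-orderIso⇒length {[]}     {[]}     _ = refl
T-orderIso⇒length {x ∷ xs} {y ∷ ys} t =
  cong suc (T-orderIso⇒length {xs} {ys} (proj₂ (T-∧ {headAgrees x y xs ys} .to t)))

T-orderIso₃ : ∀ {a b c p q r} → T (orderIso (a ∷ b ∷ c ∷ []) (p ∷ q ∷ r ∷ [])) ⇔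
  (SameComparison (a , p) (b , q) × SameComparison (a , p) (c , r) × SameComparison (b , q) (c , r))
T-orderIso₃ {a} {b} {c} {p} {q} {r} = mk⇔
  (λ t → case iso .to t of λ { ((ab ∷ ac ∷ []) ∷ (bc ∷ []) ∷ [] ∷ []) → ab , ac , bc })
  (λ (ab , ac , bc) → iso .from ((ab ∷ ac ∷ []) ∷ (bc ∷ []) ∷ [] ∷ []))
  where iso = T-orderIso {a ∷ b ∷ c ∷ []} {p ∷ q ∷ r ∷ []} refl

orderIso-123⇔ : ∀ {a b c} → T (orderIso (a ∷ b ∷ c ∷ []) (1 ∷ 2 ∷ 3 ∷ [])) ⇔ (a < b × b < c)
orderIso-123⇔ {a} {b} {c} = mk⇔
  (λ t → let (ab , _ , bc) = iso₃ .to t in ascent⇔< .to ab , ascent⇔< .to bc)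
  (λ (a<b , b<c) → iso₃ .from
    (ascent⇔< .from a<b , ascent⇔< .from (<-trans a<b b<c) , ascent⇔< .from b<c))
  where iso₃ = T-orderIso₃ {a} {b} {c} {1} {2} {3}

orderIso-321⇔ : ∀ {a b c} → T (orderIso (a ∷ b ∷ c ∷ []) (3 ∷ 2 ∷ 1 ∷ [])) ⇔ (c < b × b < a)
orderIso-321⇔ {a} {b} {c} = mk⇔
  (λ t → let (ab , _ , bc) = iso₃ .to t in ascent⇔< .to (swap bc) , ascent⇔< .to (swap ab))
  (λ (c<b , b<a) → iso₃ .from
    (swap (ascent⇔< .from b<a) , swap (ascent⇔< .from (<-trans c<b b<a)) , swap (ascent⇔< .from c<b)))
  where iso₃ = T-orderIso₃ {a} {b} {c} {3} {2} {1}

orderIso-132⇔ : ∀ {a b c} → T (orderIso (a ∷ b ∷ c ∷ []) (1 ∷ 3 ∷ 2 ∷ [])) ⇔ Is132 a b c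
orderIso-132⇔ {a} {b} {c} = mk⇔
  (λ t → let (_ , ac , bc) = iso₃ .to t in ascent⇔< .to ac , ascent⇔< .to (swap bc))
  (λ (a<c , c<b) → iso₃ .from
    (ascent⇔< .from (<-trans a<c c<b) , ascent⇔< .from a<c , swap (ascent⇔< .from c<b)))
  where iso₃ = T-orderIso₃ {a} {b} {c} {1} {3} {2}

orderIso-213⇔ : ∀ {a b c} → T (orderIso (a ∷ b ∷ c ∷ []) (2 ∷ 1 ∷ 3 ∷ [])) ⇔ Is213 a b c
orderIso-213⇔ {a} {b} {c} = mk⇔
  (λ t → let (ab , ac , _) = iso₃ .to t in ascent⇔< .to ac , ascent⇔< .to (swap ab))
  (λ (a<c , b<a) → iso₃ .from
    (swap (ascent⇔< .from b<a) , ascent⇔< .from a<c , ascent⇔< .from (<-trans b<a a<c)))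
  where iso₃ = T-orderIso₃ {a} {b} {c} {2} {1} {3}

∈-embeds⁻ : ∀ ps {w ys} → ys ∈ embeds (map [_] ps) w → ys ⊆ w × length ys ≡ length ps
∈-embeds⁻ []       (here refl) = Sublist.[]⊆-universal _ , refl
∈-embeds⁻ (p ∷ ps) {x ∷ w} ys∈ with ∈-++⁻ (embeds (map [_] (p ∷ ps)) w) ys∈
... | inj₁ ys∈′ = let (s , e) = ∈-embeds⁻ (p ∷ ps) ys∈′ in x ∷ʳ s , e
... | inj₂ ys∈′ with ∈-map⁻ (x ∷_) ys∈′
...   | zs , zs∈ , refl = let (s , e) = ∈-embeds⁻ ps zs∈ in refl ∷ s , cong suc e

∈-embeds⁺ : ∀ ps {w ys} → ys ⊆ w → length ys ≡ length ps → ys ∈ embeds (map [_] ps) w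
∈-embeds⁺ []       {ys = []} _ _ = here refl
∈-embeds⁺ (p ∷ ps) (x ∷ʳ s)   e = ∈-++⁺ˡ (∈-embeds⁺ (p ∷ ps) s e)
∈-embeds⁺ (p ∷ ps) {x ∷ w} (refl ∷ s) e =
  ∈-++⁺ʳ (embeds (map [_] (p ∷ ps)) w) (∈-map⁺ (x ∷_) (∈-embeds⁺ ps s (suc-injective e)))

T-contains⇔ : ∀ σ w → T (contains σ w) ⇔ Any (λ ys → T (orderIso ys (concat σ))) (embeds σ w)
T-contains⇔ σ w = ⇔-sym Any.any⇔

T-contains₃ : ∀ {p q r w} → T (contains (map [_] (p ∷ q ∷ r ∷ [])) w) ⇔
  Occurs (λ a b c → T (orderIso (a ∷ b ∷ c ∷ []) (p ∷ q ∷ r ∷ []))) w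
T-contains₃ {p} {q} {r} {w} = mk⇔
  (λ t → let (ys , ys∈ , iso) = find (T-contains⇔ (map [_] ps) w .to t) ; (s , len) = ∈-embeds⁻ ps ys∈
         in occurrence s len iso)
  (λ (a , b , c , s , iso) → T-contains⇔ (map [_] ps) w .from (lose (∈-embeds⁺ ps s refl) iso))
  where
  ps = p ∷ q ∷ r ∷ []
  occurrence : ∀ {ys} → ys ⊆ w → length ys ≡ 3 → T (orderIso ys ps) →
    Occurs (λ a b c → T (orderIso (a ∷ b ∷ c ∷ []) ps)) w
  occurrence {a ∷ b ∷ c ∷ []} s _ iso = a , b , c , s , iso

avoids⇔ : ∀ {σ w} {P : Set} → T (contains σ w) ⇔ P → Avoids w σ ⇔ (¬ P)
avoids⇔ contains⇔P = ¬-cong-⇔ contains⇔P ⇔-∘ ≡false⇔¬T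

avoids-132⇔ : ∀ {w} → Avoids w p132 ⇔ (¬ Occurs Is132 w)
avoids-132⇔ {w} = avoids⇔ {p132} {w} (Occurs-cong orderIso-132⇔ ⇔-∘ T-contains₃ {1} {3} {2} {w})

avoids-213⇔ : ∀ {w} → Avoids w p213 ⇔ (¬ Occurs Is213 w)
avoids-213⇔ {w} = avoids⇔ {p213} {w} (Occurs-cong orderIso-213⇔ ⇔-∘ T-contains₃ {2} {1} {3} {w})

data Has1̲2̲3 : List ℕ → Set where
  here  : ∀ {x y t} → x < y → Any (y <_) t → Has1̲2̲3 (x ∷ y ∷ t)
  there : ∀ {x w} → Has1̲2̲3 w → Has1̲2̲3 (x ∷ w)

T-contains-1̲2̲3 : ∀ {w} → T (contains p1̲2̲3 w) ⇔ Has1̲2̲3 w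
T-contains-1̲2̲3 = mk⇔ sound complete
  where
  sound : ∀ {w} → T (contains p1̲2̲3 w) → Has1̲2̲3 w
  sound {x ∷ w} c with Any.++⁻ (embeds p1̲2̲3 w) (T-contains⇔ p1̲2̲3 (x ∷ w) .to c)
  ... | inj₁ c′ = there (sound (T-contains⇔ p1̲2̲3 w .from c′))
  sound {x ∷ y ∷ t} c | inj₂ c′ =
    let (ys , ys∈ , iso) = find (Any.map⁻ c′) in headOccurrence (∈-embeds⁻ (3 ∷ []) ys∈) iso
    where
    headOccurrence : ∀ {ys} → ys ⊆ t × length ys ≡ 1 → T (orderIso (x ∷ y ∷ ys) (1 ∷ 2 ∷ 3 ∷ [])) →
      Has1̲2̲3 (x ∷ y ∷ t)
    headOccurrence {z ∷ []} (z⊆t , _) iso =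
      let (x<y , y<z) = orderIso-123⇔ .to iso in here x<y (lose (to∈ z⊆t) y<z)
  complete : ∀ {w} → Has1̲2̲3 w → T (contains p1̲2̲3 w)
  complete {x ∷ y ∷ t} (here x<y y<t) =
    let (z , z∈t , y<z) = find y<t
    in T-contains⇔ p1̲2̲3 (x ∷ y ∷ t) .from (Any.++⁺ʳ (embeds p1̲2̲3 (y ∷ t))
         (Any.map⁺ (lose (∈-embeds⁺ (3 ∷ []) (from∈ z∈t) refl) (orderIso-123⇔ .from (x<y , y<z)))))
  complete {x ∷ w} (there h) =
    T-contains⇔ p1̲2̲3 (x ∷ w) .from (Any.++⁺ˡ (T-contains⇔ p1̲2̲3 w .to (complete h)))

Has1̲2̲3-++ˡ : ∀ u {v} → Has1̲2̲3 v → Has1̲2̲3 (u ++ v)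
Has1̲2̲3-++ˡ []      h = h
Has1̲2̲3-++ˡ (_ ∷ u) h = there (Has1̲2̲3-++ˡ u h)

Has1̲2̲3-ʳ++ : ∀ xs {v} → Has1̲2̲3 v → Has1̲2̲3 (xs ʳ++ v)
Has1̲2̲3-ʳ++ []       h = h
Has1̲2̲3-ʳ++ (x ∷ xs) h = Has1̲2̲3-ʳ++ xs (there h)

Has1̲2̲3-split : ∀ {v} → Has1̲2̲3 v →
  ∃[ u ] ∃[ x ] ∃[ y ] ∃[ t ] v ≡ u ++ x ∷ y ∷ t × x < y × Any (y <_) t
Has1̲2̲3-split (here x<y y<t) = [] , _ , _ , _ , refl , x<y , y<t
Has1̲2̲3-split {a ∷ _} (there h) =
  let (u , x , y , t , eq , x<y , y<t) = Has1̲2̲3-split h in a ∷ u , x , y , t , cong (a ∷_) eq , x<y , y<t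

-- embeds ((2 ∷ 1 ∷ []) ∷ []) w lists the windows of length 2 of w, plus the last entry of w alone.
∈-adjacentPairs⁻ : ∀ w {y z} → (y ∷ z ∷ []) ∈ embeds ((2 ∷ 1 ∷ []) ∷ []) w →
  ∃[ u ] ∃[ t ] w ≡ u ++ y ∷ z ∷ t
∈-adjacentPairs⁻ (a ∷ w) m with ∈-++⁻ (embeds ((2 ∷ 1 ∷ []) ∷ []) w) m
... | inj₁ m′ = let (u , t , eq) = ∈-adjacentPairs⁻ w m′ in a ∷ u , t , cong (a ∷_) eq
∈-adjacentPairs⁻ (a ∷ b ∷ w) m | inj₂ (here refl) = [] , w , refl

∈-adjacentPairs⁺ : ∀ u {y z t} → (y ∷ z ∷ []) ∈ embeds ((2 ∷ 1 ∷ []) ∷ []) (u ++ y ∷ z ∷ t)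
∈-adjacentPairs⁺ []      {z = z} {t} = ∈-++⁺ʳ (embeds ((2 ∷ 1 ∷ []) ∷ []) (z ∷ t)) (here refl)
∈-adjacentPairs⁺ (_ ∷ u)             = ∈-++⁺ˡ (∈-adjacentPairs⁺ u)

Has32̲1̲ : List ℕ → Set
Has32̲1̲ w = ∃[ u ] ∃[ y ] ∃[ z ] ∃[ t ] w ≡ u ++ y ∷ z ∷ t × z < y × Any (y <_) u

T-contains-32̲1̲ : ∀ {w} → T (contains p32̲1̲ w) ⇔ Has32̲1̲ w
T-contains-32̲1̲ = mk⇔ sound
  (λ (u , y , z , t , eq , z<y , y<u) → subst (T ∘ contains p32̲1̲) (sym eq) (complete u z<y y<u))
  where
  sound : ∀ {w} → T (contains p32̲1̲ w) → Has32̲1̲ w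
  sound {x ∷ xs} c with Any.++⁻ (embeds p32̲1̲ xs) (T-contains⇔ p32̲1̲ (x ∷ xs) .to c)
  ... | inj₁ c′ = let (u , y , z , t , eq , z<y , y<u) = sound (T-contains⇔ p32̲1̲ xs .from c′)
                  in x ∷ u , y , z , t , cong (x ∷_) eq , z<y , there y<u
  ... | inj₂ c′ = let (ys , ys∈ , iso) = find (Any.map⁻ c′)
                  in descentBelow ys∈ (suc-injective (T-orderIso⇒length {x ∷ ys} iso)) iso
    where
    descentBelow : ∀ {ys} → ys ∈ embeds ((2 ∷ 1 ∷ []) ∷ []) xs → length ys ≡ 2 →
      T (orderIso (x ∷ ys) (3 ∷ 2 ∷ 1 ∷ [])) → Has32̲1̲ (x ∷ xs)
    descentBelow {y ∷ z ∷ []} ys∈ _ iso =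
      let (u , t , eq) = ∈-adjacentPairs⁻ xs ys∈ ; (z<y , y<x) = orderIso-321⇔ .to iso
      in x ∷ u , y , z , t , cong (x ∷_) eq , z<y , here y<x
  complete : ∀ u {y z t} → z < y → Any (y <_) u → T (contains p32̲1̲ (u ++ y ∷ z ∷ t))
  complete (x ∷ u) {y} {z} {t} z<y (here y<x) =
    T-contains⇔ p32̲1̲ (x ∷ u ++ y ∷ z ∷ t) .from (Any.++⁺ʳ (embeds p32̲1̲ (u ++ y ∷ z ∷ t))
      (Any.map⁺ (lose (∈-adjacentPairs⁺ u) (orderIso-321⇔ .from (z<y , y<x)))))
  complete (x ∷ u) {y} {z} {t} z<y (there y<u) =
    T-contains⇔ p32̲1̲ (x ∷ u ++ y ∷ z ∷ t) .from
      (Any.++⁺ˡ (T-contains⇔ p32̲1̲ (u ++ y ∷ z ∷ t) .to (complete u z<y y<u)))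

reverse-middle : ∀ (u : List ℕ) y z t → reverse (u ++ y ∷ z ∷ t) ≡ reverse t ++ z ∷ y ∷ reverse u
reverse-middle u y z t = begin
  reverse (u ++ (y ∷ z ∷ []) ++ t)              ≡⟨ reverse-++ u ((y ∷ z ∷ []) ++ t) ⟩
  reverse ((y ∷ z ∷ []) ++ t) ++ reverse u      ≡⟨ cong (_++ reverse u) (reverse-++ (y ∷ z ∷ []) t) ⟩
  (reverse t ++ z ∷ y ∷ []) ++ reverse u        ≡⟨ ++-assoc (reverse t) (z ∷ y ∷ []) (reverse u) ⟩
  reverse t ++ z ∷ y ∷ reverse u                ∎
  where open ≡-Reasoning

Has32̲1̲⇔Has1̲2̲3-reverse : ∀ {w} → Has32̲1̲ w ⇔ Has1̲2̲3 (reverse w)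
Has32̲1̲⇔Has1̲2̲3-reverse {w} = mk⇔
  (λ (u , y , z , t , eq , z<y , y<u) →
    subst Has1̲2̲3 (sym (trans (cong reverse eq) (reverse-middle u y z t)))
      (Has1̲2̲3-++ˡ (reverse t) (here z<y (Any.reverse⁺ y<u))))
  (λ h → let (u , x , y , t , eq , x<y , y<t) = Has1̲2̲3-split h in
    reverse t , y , x , reverse u ,
    trans (sym (reverse-involutive w)) (trans (cong reverse eq) (reverse-middle u x y t)) , x<y , Any.reverse⁺ y<t)

avoids-32̲1̲⇔ : ∀ {w} → Avoids w p32̲1̲ ⇔ (¬ Has1̲2̲3 (reverse w))
avoids-32̲1̲⇔ {w} = avoids⇔ {p32̲1̲} {w} (Has32̲1̲⇔Has1̲2̲3-reverse ⇔-∘ T-contains-32̲1̲ {w})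

-- Stack machines

module Stack {A : Set} (pops? : A → A → List A → Bool) where

  pop : A → List A → List A × List A
  pop x []       = [] , []
  pop x (t ∷ st) = if pops? x t st then map₁ (t ∷_) (pop x st) else ([] , t ∷ st)

  popped remaining : A → List A → List A
  popped x st    = proj₁ (pop x st)
  remaining x st = proj₂ (pop x st)

  run : List A → List A → List A
  run []       st = st
  run (x ∷ xs) st = popped x st ++ run xs (x ∷ remaining x st)

  emitted stackAfter : List A → List A → List A
  emitted []       st = []
  emitted (x ∷ xs) st = popped x st ++ emitted xs (x ∷ remaining x st)
  stackAfter []       st = st
  stackAfter (x ∷ xs) st = stackAfter xs (x ∷ remaining x st)

  popped++remaining : ∀ x st → popped x st ++ remaining x st ≡ st
  popped++remaining x []       = refl
  popped++remaining x (t ∷ st) with pops? x t st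
  ... | true  = cong (t ∷_) (popped++remaining x st)
  ... | false = refl

  run-++ : ∀ xs ys st → run (xs ++ ys) st ≡ emitted xs st ++ run ys (stackAfter xs st)
  run-++ []       ys st = refl
  run-++ (x ∷ xs) ys st = begin
    popped x st ++ run (xs ++ ys) st′
      ≡⟨ cong (popped x st ++_) (run-++ xs ys st′) ⟩
    popped x st ++ emitted xs st′ ++ run ys (stackAfter xs st′)
      ≡⟨ ++-assoc (popped x st) _ _ ⟨
    (popped x st ++ emitted xs st′) ++ run ys (stackAfter xs st′) ∎
    where open ≡-Reasoning
          st′ = x ∷ remaining x st

  run≡emitted++stackAfter : ∀ xs st → run xs st ≡ emitted xs st ++ stackAfter xs st
  run≡emitted++stackAfter xs st = begin
    run xs st                                 ≡⟨ cong (λ ys → run ys st) (++-identityʳ xs) ⟨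
    run (xs ++ []) st                         ≡⟨ run-++ xs [] st ⟩
    emitted xs st ++ stackAfter xs st         ∎
    where open ≡-Reasoning

  run-↭ : ∀ xs st → run xs st ↭ xs ++ st
  run-↭ []       st = ↭-refl
  run-↭ (x ∷ xs) st = begin
    out ++ run xs (x ∷ rest)  ↭⟨ ++⁺ˡ out (run-↭ xs (x ∷ rest)) ⟩
    out ++ xs ++ x ∷ rest     ↭⟨ shifts out xs ⟩
    xs ++ out ++ x ∷ rest     ↭⟨ ++⁺ˡ xs (shift x out rest) ⟩
    xs ++ x ∷ out ++ rest     ↭⟨ shift x xs (out ++ rest) ⟩
    x ∷ xs ++ out ++ rest     ≡⟨ cong (λ s → x ∷ xs ++ s) (popped++remaining x st) ⟩
    x ∷ xs ++ st              ∎
    where open PermutationReasoning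
          out = popped x st
          rest = remaining x st

  All-emitted++stackAfter : ∀ {P : A → Set} xs st → All P (xs ++ st) →
    All P (emitted xs st ++ stackAfter xs st)
  All-emitted++stackAfter xs st =
    All-resp-↭ (↭-trans (↭-sym (run-↭ xs st)) (↭-reflexive (run≡emitted++stackAfter xs st)))

  All-emitted : ∀ {P : A → Set} xs st → All P (xs ++ st) → All P (emitted xs st)
  All-emitted xs st = AllP.++⁻ˡ (emitted xs st) ∘ All-emitted++stackAfter xs st

  All-stackAfter : ∀ {P : A → Set} xs st → All P (xs ++ st) → All P (stackAfter xs st)
  All-stackAfter xs st = AllP.++⁻ʳ (emitted xs st) ∘ All-emitted++stackAfter xs st

module _ {A : Set} (pops₁? pops₂? : A → A → List A → Bool) (bottom : List A) where
  private
    module M₁ = Stack pops₁?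
    module M₂ = Stack pops₂?

  run-above : (Inv : List A → Set) (Ok : A → Set) →
    (∀ {x S} → Ok x → Inv S →
      M₁.pop x (S ++ bottom) ≡ (M₂.popped x S , M₂.remaining x S ++ bottom) × Inv (x ∷ M₂.remaining x S)) →
    ∀ {xs S} → All Ok xs → Inv S → M₁.run xs (S ++ bottom) ≡ M₂.run xs S ++ bottom
  run-above Inv Ok step {[]}     []          _   = refl
  run-above Inv Ok step {x ∷ xs} {S} (ok ∷ oks) inv = begin
    M₁.popped x (S ++ bottom) ++ M₁.run xs (x ∷ M₁.remaining x (S ++ bottom))
      ≡⟨ cong₂ (λ out rest → out ++ M₁.run xs (x ∷ rest)) (cong proj₁ pop≡) (cong proj₂ pop≡) ⟩
    M₂.popped x S ++ M₁.run xs ((x ∷ M₂.remaining x S) ++ bottom)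
      ≡⟨ cong (M₂.popped x S ++_) (run-above Inv Ok step oks inv′) ⟩
    M₂.popped x S ++ M₂.run xs (x ∷ M₂.remaining x S) ++ bottom
      ≡⟨ ++-assoc (M₂.popped x S) _ _ ⟨
    (M₂.popped x S ++ M₂.run xs (x ∷ M₂.remaining x S)) ++ bottom ∎
    where open ≡-Reasoning
          pop≡ = proj₁ (step ok inv)
          inv′ = proj₂ (step ok inv)

-- Knuth's analysis of one pass of a stack, for any strict total order

module Knuth {A : Set} {_≺_ : Rel A 0ℓ} (isSTO : IsStrictTotalOrder _≡_ _≺_) (_≺?_ : Decidable _≺_) where
  open IsStrictTotalOrder isSTO using (asym; compare) renaming (trans to ≺-trans)

  pops? : A → A → List A → Bool
  pops? x t _ = does (t ≺? x)

  open Stack pops? public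

  sort : List A → List A
  sort w = run w []

  Pattern231 Pattern213 : A → A → A → Set
  Pattern231 a b c = c ≺ a × a ≺ b
  Pattern213 a b c = a ≺ c × b ≺ a

  sort-↭ : ∀ w → sort w ↭ w
  sort-↭ w = ↭-trans (run-↭ w []) (↭-reflexive (++-identityʳ w))

  data MaxView : List A → Set where
    []    : MaxView []
    split : ∀ L m R → All (_≺ m) L → All (_≺ m) R → MaxView (L ++ m ∷ R)

  maxView : ∀ {w} → Unique w → MaxView w
  maxView {[]}    []         = []
  maxView {x ∷ _} (x∉ ∷ u) with maxView u
  ... | []                    = split [] x [] [] []
  ... | split L m R L≺m R≺m with compare x m
  ...   | tri< x≺m _ _ = split (x ∷ L) m R (x≺m ∷ L≺m) R≺m
  ...   | tri≈ _ x≡m _ = ⊥-elim (All.lookup x∉ (∈-++⁺ʳ L (here refl)) x≡m)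
  ...   | tri> _ _ m≺x = split [] x (L ++ m ∷ R) []
                           (AllP.++⁺ (All.map (λ y≺m → ≺-trans y≺m m≺x) L≺m)
                                     (m≺x ∷ All.map (λ y≺m → ≺-trans y≺m m≺x) R≺m))

  pop-stops-at-larger : ∀ {x m} → x ≺ m → ∀ S →
    pop x (S ++ m ∷ []) ≡ (popped x S , remaining x S ++ m ∷ [])
  pop-stops-at-larger {x} {m} x≺m [] rewrite dec-false (m ≺? x) (asym x≺m) = refl
  pop-stops-at-larger {x} x≺m (t ∷ S) with does (t ≺? x)
  ... | true  = cong (map₁ (t ∷_)) (pop-stops-at-larger x≺m S)
  ... | false = refl

  pop-all-smaller : ∀ {m} S → All (_≺ m) S → pop m S ≡ (S , [])
  pop-all-smaller []      []          = refl
  pop-all-smaller {m} (t ∷ S) (t≺m ∷ S≺m) rewrite dec-true (t ≺? m) t≺m | pop-all-smaller S S≺m = refl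

  sort-split : ∀ {L m R} → All (_≺ m) L → All (_≺ m) R → sort (L ++ m ∷ R) ≡ sort L ++ sort R ++ m ∷ []
  sort-split {L} {m} {R} L≺m R≺m = begin
    run (L ++ m ∷ R) []
      ≡⟨ run-++ L (m ∷ R) [] ⟩
    emitted L [] ++ popped m S ++ run R (m ∷ remaining m S)
      ≡⟨ cong (λ p → emitted L [] ++ proj₁ p ++ run R (m ∷ proj₂ p))
              (pop-all-smaller S (All-stackAfter L [] (AllP.++⁺ L≺m []))) ⟩
    emitted L [] ++ S ++ run R ([] ++ m ∷ [])
      ≡⟨ ++-assoc (emitted L []) S _ ⟨
    (emitted L [] ++ S) ++ run R ([] ++ m ∷ [])
      ≡⟨ cong₂ _++_ (sym (run≡emitted++stackAfter L []))
                    (run-above pops? pops? (m ∷ []) (λ _ → ⊤) (_≺ m)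
                       (λ {_} {S} x≺m _ → pop-stops-at-larger x≺m S , tt) R≺m tt) ⟩
    sort L ++ sort R ++ m ∷ [] ∎
    where open ≡-Reasoning
          S = stackAfter L []

  sorted-split : ∀ {X Y m} → All (_≺ m) X → All (_≺ m) Y →
    AllPairs _≺_ (X ++ Y ++ m ∷ []) ⇔ (AllPairs _≺_ X × AllPairs _≺_ Y × All (λ a → All (a ≺_) Y) X)
  sorted-split {X} {Y} {m} X≺m Y≺m = mk⇔
    (λ sorted → let (sX , sYm , X≺Ym) = AllPairs-++⁻ X sorted
                in sX , proj₁ (AllPairs-++⁻ Y sYm) , All.map (AllP.++⁻ˡ Y) X≺Ym)
    (λ (sX , sY , X≺Y) → APP.++⁺ sX (APP.++⁺ sY ([] ∷ []) (All.map (_∷ []) Y≺m))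
                           (All.zipWith (λ (a≺Y , a≺m) → AllP.++⁺ a≺Y (a≺m ∷ [])) (X≺Y , X≺m)))

  231-free-split : ∀ {L m R} → Unique (L ++ m ∷ R) → All (_≺ m) L → All (_≺ m) R →
    (¬ Occurs Pattern231 (L ++ m ∷ R)) ⇔
      ((¬ Occurs Pattern231 L) × (¬ Occurs Pattern231 R) × All (λ a → All (a ≺_) R) L)
  231-free-split {L} {m} {R} u L≺m R≺m = mk⇔
    (λ free → (free ∘ Occurs-mono (Sublist.++⁺ʳ (m ∷ R) ⊆-refl)) ,
              (free ∘ Occurs-mono (Sublist.++⁺ˡ L (m ∷ʳ ⊆-refl))) ,
              All.tabulate (λ a∈L → All.tabulate (λ c∈R → ordered free a∈L c∈R)))
    (λ (freeL , freeR , L≺R) (_ , _ , _ , s , c≺a , a≺b) → no-occurrence freeL freeR L≺R c≺a a≺b (⊆-++⁻ L s))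
    where
    ordered : ¬ Occurs Pattern231 (L ++ m ∷ R) → ∀ {a c} → a ∈ L → c ∈ R → a ≺ c
    ordered free {a} {c} a∈L c∈R with compare a c
    ... | tri< a≺c _ _ = a≺c
    ... | tri≈ _ a≡c _ =
      ⊥-elim (All.lookup (All.lookup (proj₂ (proj₂ (AllPairs-++⁻ L u))) a∈L) (there c∈R) a≡c)
    ... | tri> _ _ c≺a =
      ⊥-elim (free (a , m , c , Sublist.++⁺ (from∈ a∈L) (refl ∷ from∈ c∈R) , c≺a , All.lookup L≺m a∈L))
    no-occurrence : ∀ {a b c} → ¬ Occurs Pattern231 L → ¬ Occurs Pattern231 R → All (λ a → All (a ≺_) R) L →
      c ≺ a → a ≺ b → (∃[ xs₁ ] ∃[ xs₂ ] a ∷ b ∷ c ∷ [] ≡ xs₁ ++ xs₂ × xs₁ ⊆ L × xs₂ ⊆ m ∷ R) → ⊥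
    no-occurrence _ _ _ _ a≺b ([] , _ , refl , _ , refl ∷ s₂) = asym a≺b (All.lookup R≺m (to∈ s₂))
    no-occurrence _ freeR _ c≺a a≺b ([] , _ , refl , _ , _ ∷ʳ s₂) = freeR (_ , _ , _ , s₂ , c≺a , a≺b)
    no-occurrence _ _ L≺R c≺a _ (_ ∷ [] , _ , refl , s₁ , s₂) =
      asym c≺a (All.lookup (All.lookup L≺R (to∈ s₁)) (to∈ (∷⁻ s₂)))
    no-occurrence _ _ L≺R c≺a _ (_ ∷ _ ∷ [] , _ , refl , s₁ , s₂) with to∈ s₂
    ... | here refl = asym c≺a (All.lookup L≺m (to∈ s₁))
    ... | there c∈R = asym c≺a (All.lookup (All.lookup L≺R (to∈ s₁)) c∈R)
    no-occurrence freeL _ _ c≺a a≺b (_ ∷ _ ∷ _ ∷ [] , _ , refl , s₁ , _) = freeL (_ , _ , _ , s₁ , c≺a , a≺b)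

  sorted-sort⇔231-free : ∀ {w} → Unique w → AllPairs _≺_ (sort w) ⇔ (¬ Occurs Pattern231 w)
  sorted-sort⇔231-free {w} = go (On.wellFounded length <-wellFounded w)
    where
    go : ∀ {w} → Acc (_<_ on length) w → Unique w → AllPairs _≺_ (sort w) ⇔ (¬ Occurs Pattern231 w)
    go (acc rec) u with maxView u
    ... | [] = mk⇔ (λ _ → λ { (_ , _ , _ , () , _) }) (const [])
    ... | split L m R L≺m R≺m = begin
      AllPairs _≺_ (sort (L ++ m ∷ R))
        ≡⟨ cong (AllPairs _≺_) (sort-split L≺m R≺m) ⟩
      AllPairs _≺_ (sort L ++ sort R ++ m ∷ [])
        ∼⟨ sorted-split (All-resp-↭ (↭-sym (sort-↭ L)) L≺m) (All-resp-↭ (↭-sym (sort-↭ R)) R≺m) ⟩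
      (AllPairs _≺_ (sort L) × AllPairs _≺_ (sort R) × All (λ a → All (a ≺_) (sort R)) (sort L))
        ∼⟨ go (rec (length-<-++ˡ L)) uL ×-⇔ go (rec (length-<-++ʳ L)) uR ×-⇔ All²-resp-↭⇔ (sort-↭ L) (sort-↭ R) ⟩
      ((¬ Occurs Pattern231 L) × (¬ Occurs Pattern231 R) × All (λ a → All (a ≺_) R) L)
        ∼⟨ ⇔-sym (231-free-split u L≺m R≺m) ⟩
      (¬ Occurs Pattern231 (L ++ m ∷ R)) ∎
      where
      open Related.EquationalReasoning
      uL = proj₁ (AllPairs-++⁻ L u)
      uR = AllPairs.tail (proj₁ (proj₂ (AllPairs-++⁻ L u)))

  sorted-before-max : ∀ {Y m} → Unique Y → All (_≺ m) Y → ¬ Occurs Pattern213 (Y ++ m ∷ []) →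
    AllPairs _≺_ (Y ++ m ∷ [])
  sorted-before-max {[]}    _          _            _    = [] ∷ []
  sorted-before-max {y ∷ Y} {m} (y∉ ∷ u) (y≺m ∷ Y≺m) free =
    AllP.++⁺ (All.tabulate below) (y≺m ∷ []) ∷ sorted-before-max u Y≺m (free ∘ Occurs-mono (y ∷ʳ ⊆-refl))
    where
    below : ∀ {v} → v ∈ Y → y ≺ v
    below {v} v∈Y with compare y v
    ... | tri< y≺v _ _ = y≺v
    ... | tri≈ _ y≡v _ = ⊥-elim (All.lookup y∉ v∈Y y≡v)
    ... | tri> _ _ v≺y = ⊥-elim (free (y , v , m , refl ∷ Sublist.++⁺ (from∈ v∈Y) (refl ∷ []) , y≺m , v≺y))

  -- sort w ends with the maximum of w, so an inversion of sort w followed by it is a 213.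
  sorted-sort⇔213-free : ∀ {w} → Unique w → AllPairs _≺_ (sort w) ⇔ (¬ Occurs Pattern213 (sort w))
  sorted-sort⇔213-free u = mk⇔
    (λ sorted → λ (a , b , c , s , a≺c , b≺a) → asym b≺a (AllPairs-pair s sorted))
    (sorted-if-213-free u)
    where
    sorted-if-213-free : ∀ {w} → Unique w → ¬ Occurs Pattern213 (sort w) → AllPairs _≺_ (sort w)
    sorted-if-213-free u free with maxView u
    ... | [] = []
    ... | split L m R L≺m R≺m =
      subst (AllPairs _≺_) (sym shape) (sorted-before-max uY Y≺m (free ∘ subst (Occurs Pattern213) (sym shape)))
      where
      Y = sort L ++ sort R
      shape : sort (L ++ m ∷ R) ≡ Y ++ m ∷ []
      shape = trans (sort-split L≺m R≺m) (sym (++-assoc (sort L) (sort R) (m ∷ [])))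
      uY = proj₁ (AllPairs-++⁻ Y (subst Unique shape (Unique-resp-↭ (↭-sym (sort-↭ (L ++ m ∷ R))) u)))
      Y≺m = AllP.++⁺ (All-resp-↭ (↭-sym (sort-↭ L)) L≺m) (All-resp-↭ (↭-sym (sort-↭ R)) R≺m)

module West  = Knuth <-isStrictTotalOrder _<?_

-- West's map for the reversed order; its Pattern231 is Is213 and its Pattern213 is Is231.
module Westᵒᵖ = Knuth (Flip.isStrictTotalOrder <-isStrictTotalOrder) _>?_

popSmaller≡West-pop : ∀ x st → popSmaller x st ≡ West.pop x st
popSmaller≡West-pop x []       = refl
popSmaller≡West-pop x (t ∷ st) with t <ᵇ x
... | true  = cong (map₁ (t ∷_)) (popSmaller≡West-pop x st)
... | false = refl

west≡West-sort : ∀ w → west w ≡ West.sort w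
west≡West-sort w = go w []
  where
  go : ∀ xs st → runWest xs st ≡ West.run xs st
  go []       st = refl
  go (x ∷ xs) st rewrite popSmaller≡West-pop x st = cong (West.popped x st ++_) (go xs _)

idPerm-sorted : ∀ n → AllPairs _<_ (idPerm n)
idPerm-sorted n = APP.map⁺ (APP.applyUpTo⁺₁ (λ i → i) n (λ i<j _ → s≤s i<j))

sorted-↭⇒≡ : ∀ {xs ys} → AllPairs _<_ xs → AllPairs _<_ ys → xs ↭ ys → xs ≡ ys
sorted-↭⇒≡ xs↗ ys↗ xs↭ys =
  Pointwise-≡⇒≡ (↗↭↗⇒≋ ≤-totalOrder (↗ xs↗) (↗ ys↗) (↭⇒↭ₛ xs↭ys))
  where
  ↗ : ∀ {zs} → AllPairs _<_ zs → Sorted ≤-totalOrder zs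
  ↗ = AllPairs⇒Linked ∘ AllPairs.map <⇒≤

perm-unique : ∀ {n w} → IsPerm n w → Unique w
perm-unique {n} w↭id = Unique-resp-↭ (↭-sym w↭id) (AllPairs.map <⇒≢ (idPerm-sorted n))

west-sorts⇔231-free : ∀ {n w} → IsPerm n w → (west w ≡ idPerm n) ⇔ (¬ Occurs Is231 w)
west-sorts⇔231-free {n} {w} w↭id = mk⇔
  (λ sorts → sorted⇔ .to (subst (AllPairs _<_) (trans (sym sorts) (west≡West-sort w)) (idPerm-sorted n)))
  (λ free → trans (west≡West-sort w)
              (sorted-↭⇒≡ (sorted⇔ .from free) (idPerm-sorted n) (↭-trans (West.sort-↭ w) w↭id)))
  where sorted⇔ = West.sorted-sort⇔231-free (perm-unique w↭id)

-- The stack map of 1̲2̲3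

stackMap≡run : ∀ σ τ → stackMap σ τ ≡ Stack.run (λ x t st → contains σ (x ∷ t ∷ st)) τ []
stackMap≡run σ τ = go τ []
  where
  module S = Stack (λ x t st → contains σ (x ∷ t ∷ st))
  popWhile≡pop : ∀ x st → popWhile σ x st ≡ S.pop x st
  popWhile≡pop x []       = refl
  popWhile≡pop x (t ∷ st) with contains σ (x ∷ t ∷ st)
  ... | true  = cong (map₁ (t ∷_)) (popWhile≡pop x st)
  ... | false = refl
  go : ∀ xs st → runσ σ xs st ≡ S.run xs st
  go []       st = refl
  go (x ∷ xs) st rewrite popWhile≡pop x st = cong (S.popped x st ++_) (go xs _)

module Stack₁̲₂̲₃ = Stack (λ x t st → contains p1̲2̲3 (x ∷ t ∷ st))
open Stack₁̲₂̲₃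

pops⇒Has1̲2̲3 : ∀ {w} → contains p1̲2̲3 w ≡ true → Has1̲2̲3 w
pops⇒Has1̲2̲3 c = T-contains-1̲2̲3 .to (T-≡ .from c)

¬Has1̲2̲3⇒¬pops : ∀ {w} → ¬ Has1̲2̲3 w → contains p1̲2̲3 w ≡ false
¬Has1̲2̲3⇒¬pops free = ≡false⇔¬T .from (free ∘ T-contains-1̲2̲3 .to)

remaining-free : ∀ x st → ¬ Has1̲2̲3 (x ∷ remaining x st)
remaining-free x []       (there ())
remaining-free x (t ∷ st) with contains p1̲2̲3 (x ∷ t ∷ st) in c
... | true  = remaining-free x st
... | false = ≡false⇔¬T .to c ∘ T-contains-1̲2̲3 .from

Has1̲2̲3-head : ∀ {x t st} → ¬ Has1̲2̲3 (t ∷ st) → Has1̲2̲3 (x ∷ t ∷ st) → x < t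
Has1̲2̲3-head _    (here x<t _) = x<t
Has1̲2̲3-head free (there h)    = ⊥-elim (free h)

popped-larger : ∀ x st → ¬ Has1̲2̲3 st → All (x <_) (popped x st)
popped-larger x []       _    = []
popped-larger x (t ∷ st) free with contains p1̲2̲3 (x ∷ t ∷ st) in c
... | false = []
... | true  = Has1̲2̲3-head free (pops⇒Has1̲2̲3 c) ∷ popped-larger x st (free ∘ there)

pop-free : ∀ {x st} → ¬ Has1̲2̲3 (x ∷ st) → pop x st ≡ ([] , st)
pop-free {st = []}     _    = refl
pop-free {st = _ ∷ _} free rewrite ¬Has1̲2̲3⇒¬pops free = refl

stackAfter-free : ∀ xs st → ¬ Has1̲2̲3 st → ¬ Has1̲2̲3 (stackAfter xs st)
stackAfter-free []       st free = free
stackAfter-free (x ∷ xs) st _    = stackAfter-free xs (x ∷ remaining x st) (remaining-free x st)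

no-emission-if-free : ∀ xs st → ¬ Has1̲2̲3 (xs ʳ++ st) →
  emitted xs st ≡ [] × stackAfter xs st ≡ xs ʳ++ st
no-emission-if-free []       st _    = refl , refl
no-emission-if-free (x ∷ xs) st free rewrite pop-free {x} {st} (free ∘ Has1̲2̲3-ʳ++ xs) =
  no-emission-if-free xs (x ∷ st) free

free-if-no-emission : ∀ xs st → ¬ Has1̲2̲3 st → emitted xs st ≡ [] → ¬ Has1̲2̲3 (xs ʳ++ st)
free-if-no-emission []       st free _    = free
free-if-no-emission (x ∷ xs) st _    none =
  subst (λ r → ¬ Has1̲2̲3 (xs ʳ++ (x ∷ r))) remaining≡st
    (free-if-no-emission xs (x ∷ remaining x st) (remaining-free x st) (++-conicalʳ _ _ none))
  where
  remaining≡st : remaining x st ≡ st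
  remaining≡st = trans (cong (_++ remaining x st) (sym (++-conicalˡ _ _ none))) (popped++remaining x st)

-- An entry leaves the stack only for a smaller incoming entry, which is then pushed.
emitted-covered : ∀ xs {st out} → ¬ Has1̲2̲3 st → All (λ p → Any (_< p) st) out →
  All (λ p → Any (_< p) (stackAfter xs st)) (out ++ emitted xs st)
emitted-covered []       {st} {out} _    cov = subst (All _) (sym (++-identityʳ out)) cov
emitted-covered (x ∷ xs) {st} {out} free cov =
  subst (All _) (++-assoc out (popped x st) _)
    (emitted-covered xs (remaining-free x st) (AllP.++⁺ (All.map below cov) (All.map here x<popped)))
  where
  x<popped = popped-larger x st free
  below : ∀ {p} → Any (_< p) st → Any (_< p) (x ∷ remaining x st)
  below q<p with Any.++⁻ (popped x st) (subst (Any _) (sym (popped++remaining x st)) q<p)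
  ... | inj₁ in-popped = let (q , q∈ , q<p) = find in-popped in here (<-trans (All.lookup x<popped q∈) q<p)
  ... | inj₂ in-rest   = there in-rest

push-max-free : ∀ {n Ra} → All (_< n) Ra → ¬ Has1̲2̲3 Ra → ¬ Has1̲2̲3 (n ∷ Ra)
push-max-free (y<n ∷ _) _    (here n<y _) = <-asym n<y y<n
push-max-free _         free (there h)    = free h

-- Above n, x on top of t creates a 1̲2̲3 exactly when x < t, with n as its 3.
pop-above-barrier : ∀ {n Ra x} → x < n → All (_< n) Ra → ∀ S → All (_< n) S → ¬ Has1̲2̲3 (S ++ n ∷ Ra) →
  pop x (S ++ n ∷ Ra) ≡ (Westᵒᵖ.popped x S , Westᵒᵖ.remaining x S ++ n ∷ Ra)
pop-above-barrier {n} {Ra} x<n Ra<n [] _ free = pop-free λ where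
  (here _ n<Ra) → let (y , y∈ , n<y) = find n<Ra in <-asym n<y (All.lookup Ra<n y∈)
  (there h)     → free h
pop-above-barrier {n} {Ra} {x} x<n Ra<n (t ∷ S) (t<n ∷ S<n) free
  with contains p1̲2̲3 (x ∷ t ∷ S ++ n ∷ Ra) in c | x <ᵇ t in x<ᵇt
... | true  | true  = cong (map₁ (t ∷_)) (pop-above-barrier x<n Ra<n S S<n (free ∘ there))
... | false | false = refl
... | true  | false = ⊥-elim (subst T x<ᵇt (<⇒<ᵇ (Has1̲2̲3-head free (pops⇒Has1̲2̲3 c))))
... | false | true  = ⊥-elim (≡false⇔¬T .to c (T-contains-1̲2̲3 .from
                        (here (<ᵇ⇒< x t (T-≡ .from x<ᵇt)) (Any.++⁺ʳ S (here t<n)))))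

run-above-barrier : ∀ {n Ra xs} → All (_< n) Ra → ¬ Has1̲2̲3 Ra → All (_< n) xs →
  run xs (n ∷ Ra) ≡ Westᵒᵖ.run xs [] ++ n ∷ Ra
run-above-barrier {n} {Ra} Ra<n free xs<n =
  run-above _ Westᵒᵖ.pops? (n ∷ Ra) Invariant (_< n) step xs<n ([] , push-max-free Ra<n free)
  where
  Invariant : List ℕ → Set
  Invariant S = All (_< n) S × ¬ Has1̲2̲3 (S ++ n ∷ Ra)
  step : ∀ {x S} → x < n → Invariant S →
    pop x (S ++ n ∷ Ra) ≡ (Westᵒᵖ.popped x S , Westᵒᵖ.remaining x S ++ n ∷ Ra) ×
    Invariant (x ∷ Westᵒᵖ.remaining x S)
  step {x} {S} x<n (S<n , S-free) =
    pop≡ ,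
    (x<n ∷ AllP.++⁻ʳ (Westᵒᵖ.popped x S) (subst (All (_< n)) (sym (Westᵒᵖ.popped++remaining x S)) S<n)) ,
    subst (λ p → ¬ Has1̲2̲3 (x ∷ proj₂ p)) pop≡ (remaining-free x (S ++ n ∷ Ra))
    where pop≡ = pop-above-barrier x<n Ra<n S S<n S-free

stackMap-shape : ∀ {n τa τb} → All (_< n) τa → All (_< n) τb →
  stackMap p1̲2̲3 (τa ++ n ∷ τb) ≡ emitted τa [] ++ Westᵒᵖ.sort τb ++ n ∷ stackAfter τa []
stackMap-shape {n} {τa} {τb} τa<n τb<n = begin
  stackMap p1̲2̲3 (τa ++ n ∷ τb)
    ≡⟨ stackMap≡run p1̲2̲3 (τa ++ n ∷ τb) ⟩
  run (τa ++ n ∷ τb) []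
    ≡⟨ run-++ τa (n ∷ τb) [] ⟩
  emitted τa [] ++ run (n ∷ τb) Ra
    ≡⟨ cong (λ p → emitted τa [] ++ proj₁ p ++ run τb (n ∷ proj₂ p)) (pop-free (push-max-free Ra<n Ra-free)) ⟩
  emitted τa [] ++ run τb (n ∷ Ra)
    ≡⟨ cong (emitted τa [] ++_) (run-above-barrier Ra<n Ra-free τb<n) ⟩
  emitted τa [] ++ Westᵒᵖ.sort τb ++ n ∷ Ra ∎
  where
  open ≡-Reasoning
  Ra = stackAfter τa []
  Ra<n = All-stackAfter τa [] (AllP.++⁺ τa<n [])
  Ra-free = stackAfter-free τa [] λ ()

-- 231-avoidance of 𝔰(τ)

emitted-empty : ∀ {n X Ra out} → All (λ p → Any (_< p) Ra) out → All (_< n) out →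
  ¬ Occurs Is231 (out ++ X ++ n ∷ Ra) → out ≡ []
emitted-empty []                    _          _    = refl
emitted-empty {n} {X} {out = _ ∷ out} (r<p ∷ _) (p<n ∷ _) free =
  let (r , r∈ , r<p) = find r<p
  in ⊥-elim (free (_ , n , r , refl ∷ Sublist.++⁺ˡ out (Sublist.++⁺ˡ X (refl ∷ from∈ r∈)) , r<p , p<n))

231-free-stackMap⇔ : ∀ {n τa X} → All (_< n) τa →
  (¬ Occurs Is231 (emitted τa [] ++ X ++ n ∷ stackAfter τa [])) ⇔
    ((¬ Has1̲2̲3 (reverse τa)) × (¬ Occurs Is231 (X ++ n ∷ reverse τa)))
231-free-stackMap⇔ {n} {τa} {X} τa<n = mk⇔
  (λ free → let reverse-free = free-if-no-emission τa [] (λ ()) (emitted-empty covered emitted<n free)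
            in reverse-free , subst (¬_ ∘ Occurs Is231) (shape reverse-free) free)
  (λ (reverse-free , free) → subst (¬_ ∘ Occurs Is231) (sym (shape reverse-free)) free)
  where
  covered = emitted-covered τa (λ ()) []
  emitted<n = All-emitted τa [] (AllP.++⁺ τa<n [])
  shape : ¬ Has1̲2̲3 (reverse τa) → emitted τa [] ++ X ++ n ∷ stackAfter τa [] ≡ X ++ n ∷ reverse τa
  shape reverse-free = let (none , stack≡) = no-emission-if-free τa [] reverse-free
                       in cong₂ (λ out stack → out ++ X ++ n ∷ stack) none stack≡

entries-below-max : ∀ {n τa τb} → IsPerm n (τa ++ n ∷ τb) → All (_< n) τa × All (_< n) τb
entries-below-max {n} {τa} {τb} τ↭id =
  All.tabulate (λ a∈ → ≤∧≢⇒< (bounded (∈-++⁺ˡ a∈)) (All.lookup (All.lookup τa≢ a∈) (here refl))) ,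
  All.tabulate (λ b∈ → ≤∧≢⇒< (bounded (∈-++⁺ʳ τa (there b∈))) (All.lookup n≢τb b∈ ∘ sym))
  where
  bounded : ∀ {x} → x ∈ τa ++ n ∷ τb → x ≤ n
  bounded x∈ with ∈-map⁻ suc (∈-resp-↭ τ↭id x∈)
  ... | _ , i∈ , refl = ∈-upTo⁻ i∈
  split = AllPairs-++⁻ τa (perm-unique τ↭id)
  τa≢ = proj₂ (proj₂ split)
  n≢τb = AllPairs.head (proj₁ (proj₂ split))

231-free-around-max⇔ : ∀ {n τa τb} → IsPerm n (τa ++ n ∷ τb) →
  (¬ Occurs Is231 (Westᵒᵖ.sort τb ++ n ∷ reverse τa)) ⇔
    (All (λ a → All (λ b → b < a) τb) τa × Avoids τa p132 × Avoids τb p213)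
231-free-around-max⇔ {n} {τa} {τb} τ↭id = begin
  (¬ Occurs Is231 (X ++ n ∷ reverse τa))
    ∼⟨ West.231-free-split unique (All-resp-↭ (↭-sym (Westᵒᵖ.sort-↭ τb)) τb<n)
                                  (All-resp-↭ (↭-sym (↭-reverse τa)) τa<n) ⟩
  ((¬ Occurs Is231 X) × (¬ Occurs Is231 (reverse τa)) × All (λ x → All (x <_) (reverse τa)) X)
    ∼⟨ (Westᵒᵖ.sorted-sort⇔231-free uB ⇔-∘ ⇔-sym (Westᵒᵖ.sorted-sort⇔213-free uB))
       ×-⇔ ¬-cong-⇔ Occurs-reverse ×-⇔ All²-resp-↭⇔ (Westᵒᵖ.sort-↭ τb) (↭-reverse τa) ⟩
  ((¬ Occurs Is213 τb) × (¬ Occurs Is132 τa) × All (λ b → All (b <_) τa) τb)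
    ∼⟨ mk⇔ (λ (n213 , n132 , τb<τa) → All-swap τb<τa , avoids-132⇔ .from n132 , avoids-213⇔ .from n213)
           (λ (τb<τa , a132 , a213) → avoids-213⇔ .to a213 , avoids-132⇔ .to a132 , All-swap τb<τa) ⟩
  (All (λ a → All (λ b → b < a) τb) τa × Avoids τa p132 × Avoids τb p213) ∎
  where
  open Related.EquationalReasoning
  X = Westᵒᵖ.sort τb
  τa<n = proj₁ (entries-below-max τ↭id)
  τb<n = proj₂ (entries-below-max τ↭id)
  τ-unique = perm-unique τ↭id
  uB = AllPairs.tail (proj₁ (proj₂ (AllPairs-++⁻ τa τ-unique)))
  unique : Unique (X ++ n ∷ reverse τa)
  unique = Unique-resp-↭ (begin-↭
    τa ++ n ∷ τb              ↭⟨ shift n τa τb ⟩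
    (n ∷ τa) ++ τb            ↭⟨ ++-comm (n ∷ τa) τb ⟩
    τb ++ n ∷ τa              ↭⟨ ↭-sym (++⁺ (Westᵒᵖ.sort-↭ τb) (↭-prep n (↭-reverse τa))) ⟩
    X ++ n ∷ reverse τa       ∎↭) τ-unique
    where open PermutationReasoning renaming (begin_ to begin-↭_; _∎ to _∎↭)

stackMap-↭ : ∀ {n τ} → IsPerm n τ → IsPerm n (stackMap p1̲2̲3 τ)
stackMap-↭ {τ = τ} τ↭id = begin
  stackMap p1̲2̲3 τ  ≡⟨ stackMap≡run p1̲2̲3 τ ⟩
  run τ []          ↭⟨ run-↭ τ [] ⟩
  τ ++ []           ≡⟨ ++-identityʳ τ ⟩
  τ                 ↭⟨ τ↭id ⟩
  idPerm _          ∎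
  where open PermutationReasoning

mainTheorem6 : (n : ℕ) → 1 ≤ n → (τ : List ℕ) → IsPerm n τ →
    (τa τb : List ℕ) → τ ≡ τa ++ n ∷ τb →
    InSort p1̲2̲3 n τ ⇔
      ((All (λ a → All (λ b → b < a) τb) τa) × Avoids τa p32̲1̲ × Avoids τa p132 × Avoids τb p213)
mainTheorem6 n _ τ τ↭id τa τb refl = begin
  InSort p1̲2̲3 n τ
    ∼⟨ mk⇔ proj₂ (τ↭id ,_) ⟩
  (west (stackMap p1̲2̲3 τ) ≡ idPerm n)
    ∼⟨ west-sorts⇔231-free (stackMap-↭ τ↭id) ⟩
  (¬ Occurs Is231 (stackMap p1̲2̲3 τ))
    ≡⟨ cong (¬_ ∘ Occurs Is231) (stackMap-shape τa<n τb<n) ⟩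
  (¬ Occurs Is231 (emitted τa [] ++ Westᵒᵖ.sort τb ++ n ∷ stackAfter τa []))
    ∼⟨ 231-free-stackMap⇔ τa<n ⟩
  ((¬ Has1̲2̲3 (reverse τa)) × (¬ Occurs Is231 (Westᵒᵖ.sort τb ++ n ∷ reverse τa)))
    ∼⟨ ⇔-sym (avoids-32̲1̲⇔ {τa}) ×-⇔ 231-free-around-max⇔ τ↭id ⟩
  (Avoids τa p32̲1̲ × All (λ a → All (λ b → b < a) τb) τa × Avoids τa p132 × Avoids τb p213)
    ∼⟨ mk⇔ (λ (a , c , rest) → c , a , rest) (λ (c , a , rest) → a , c , rest) ⟩
  (All (λ a → All (λ b → b < a) τb) τa × Avoids τa p32̲1̲ × Avoids τa p132 × Avoids τb p213) ∎
  where
  open Related.EquationalReasoning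
  τa<n = proj₁ (entries-below-max τ↭id)
  τb<n = proj₂ (entries-below-max τ↭id)
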